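{- Let $G$ be a finite graph containing the $r$-grid $W_r$ as a minor, witnessed by pairwise disjoint connected branch sets $V_h\subseteq V(G)$, $h\in V(W_r)$. Let $\mathcal{T}$ be the extension to $G$ of the natural tangle of $W_r$. Then for every separation $(A,B)\in\mathcal{T}$ of order $s$, the set $A$ intersects at most $s^2$ of the branch sets $V_h$.
   Context: The $r$-grid $W_r$ has vertex set $\{(i,j):1\le i,j\le r\}$, with $(i,j)$ and $(i',j')$ adjacent iff $|i-i'|+|j-j'|=1$; a cross is the union of a row $\{i\}\times\{1,\dots,r\}$ and a column $\{1,\dots,r\}\times\{j\}$. A separation of a graph is a pair $(A,B)$ of vertex sets with $A\cup B$ the whole vertex set and no edge between $A\setminus B$ and $B\setminus A$; its order is $|A\cap B|$. The natural tangle of $W_r$ is the set of all separations $(A,B)$ of $W_r$ of order less than $r$ such that $B$ contains a cross. For a separation $(A,B)$ of $G$, the induced separation of $W_r$ is $(A',B')=(\{h: V_h\cap A\neq\emptyset\},\{h: V_h\cap B\neq\emptyset\})$. The extension of the natural tangle to $G$ is the set of all separations $(A,B)$ of $G$ of order less than $r$ whose induced separation $(A',B')$ lies in the natural tangle of $W_r$. -}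

module Defs where

open import Data.Nat using (ℕ; zero; suc; _+_; _*_; _<_; _≤_; ∣_-_∣)
open import Data.Fin using (Fin; toℕ)
open import Data.Bool using (Bool; true; false; T; _∧_; not; if_then_else_)
open import Data.List using (List; map; cartesianProduct; allFin)
open import Data.Nat.ListAction using (sum)
open import Data.Bool.ListAction using (any)
open import Data.Product using (_×_; _,_; Σ; ∃; ∃-syntax)
open import Data.Sum using (_⊎_)
open import Data.Empty using (⊥)
open import Relation.Binary.PropositionalEquality using (_≡_)

record Graph : Set₁ where
  field
    n   : ℕ
    Adj : Fin n → Fin n → Set
    sym : ∀ {u v} → Adj u v → Adj v u
open Graph public

count : {V : Set} → List V → (V → Bool) → ℕ
count enum S = sum (map (λ v → if S v then 1 else 0) enum)

IsSeparation : {V : Set} → (V → V → Set) → (V → Bool) → (V → Bool) → Set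
IsSeparation E A B =
  (∀ v → T (A v) ⊎ T (B v)) ×
  (∀ u v → E u v → T (A u) → T (not (B u)) → T (B v) → T (not (A v)) → ⊥)

order : {V : Set} → List V → (V → Bool) → (V → Bool) → ℕ
order enum A B = count enum (λ v → A v ∧ B v)

-- The r-grid W_r : vertices Fin r × Fin r (coordinates 0..r-1 instead of 1..r)
GridV : ℕ → Set
GridV r = Fin r × Fin r

gridVerts : (r : ℕ) → List (GridV r)
gridVerts r = cartesianProduct (allFin r) (allFin r)

GridAdj : (r : ℕ) → GridV r → GridV r → Set
GridAdj r (i , j) (i' , j') = ∣ toℕ i - toℕ i' ∣ + ∣ toℕ j - toℕ j' ∣ ≡ 1

ContainsCross : (r : ℕ) → (GridV r → Bool) → Set
ContainsCross r B = ∃[ i ] ∃[ j ] (∀ k → T (B (i , k)) × T (B (k , j)))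

InNaturalTangle : (r : ℕ) → (GridV r → Bool) → (GridV r → Bool) → Set
InNaturalTangle r A B =
  IsSeparation (GridAdj r) A B × (order (gridVerts r) A B < r) × ContainsCross r B

data WalkIn (G : Graph) (S : Fin (n G) → Bool) : Fin (n G) → Fin (n G) → Set where
  here : ∀ {u} → T (S u) → WalkIn G S u u
  step : ∀ {u v w} → T (S u) → Adj G u v → WalkIn G S v w → WalkIn G S u w

record GridMinor (G : Graph) (r : ℕ) : Set where
  field
    branch    : GridV r → Fin (n G) → Bool
    disjoint  : ∀ h h' v → T (branch h v) → T (branch h' v) → h ≡ h'
    nonempty  : ∀ h → ∃[ v ] T (branch h v)
    connected : ∀ h u v → T (branch h u) → T (branch h v) → WalkIn G (branch h) u v
    edges     : ∀ h h' → GridAdj r h h' →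
                ∃[ u ] ∃[ v ] (T (branch h u) × T (branch h' v) × Adj G u v)
open GridMinor public

induced : {G : Graph} {r : ℕ} → GridMinor G r → (Fin (n G) → Bool) → GridV r → Bool
induced {G} M X h = any (λ v → branch M h v ∧ X v) (allFin (n G))

orderG : (G : Graph) → (Fin (n G) → Bool) → (Fin (n G) → Bool) → ℕ
orderG G A B = order (allFin (n G)) A B

InExtension : (G : Graph) (r : ℕ) → GridMinor G r → (Fin (n G) → Bool) → (Fin (n G) → Bool) → Set
InExtension G r M A B =
  IsSeparation (Adj G) A B × (orderG G A B < r) ×
  InNaturalTangle r (induced M A) (induced M B)

-- A vertex of A ∩ B lies in at most one branch set, and a branch set meeting both A and
-- B contains a vertex of A ∩ B (walk inside it from A to B); so the induced separation
-- (A′, B′) of the grid has order at most s. If (i, j) ∈ A′, walking along row i to the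
-- column of the cross in B′, and along column j to its row, meets A′ ∩ B′. Hence every
-- point of A′ lies in a row and a column both meeting A′ ∩ B′, and there are at most
-- |A′ ∩ B′|² ≤ s² such points.

module Submission where

open import Defs hiding (sym)
open import Data.Nat using (ℕ; zero; suc; _+_; _*_; _∸_; _≤_; _<_; z≤n; s≤s; ∣_-_∣)
open import Data.Fin using (Fin; toℕ; fromℕ<)
open import Data.Bool using (Bool; true; false; T; _∧_; if_then_else_)

open import Algebra.Properties.CommutativeSemigroup using (interchange)
open import Data.Bool.Properties using (T-∧)
open import Data.Empty using (⊥-elim)
open import Data.Fin.Properties using (toℕ<n; toℕ-fromℕ<; toℕ-injective)
open import Data.List using (List; []; _∷_; _++_; map; cartesianProduct; allFin)
open import Data.List.Membership.Propositional using (_∈_)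
open import Data.List.Membership.Propositional.Properties using (∈-allFin)
open import Data.List.Properties using (map-++; map-cong; map-∘)
open import Data.List.Relation.Unary.All using (All; []; _∷_)
open import Data.List.Relation.Unary.AllPairs using ([]; _∷_)
open import Data.List.Relation.Unary.Any using (here; there; satisfied)
open import Data.List.Relation.Unary.Any.Properties using (any⁻)
open import Data.List.Relation.Unary.Unique.Propositional using (Unique)
open import Data.List.Relation.Unary.Unique.Propositional.Properties using (cartesianProduct⁺; allFin⁺)
open import Data.Nat.ListAction using (sum)
open import Data.Nat.ListAction.Properties using (sum-++)
open import Data.Nat.Properties
open import Data.Product using (_×_; _,_; ∃-syntax; proj₁; proj₂)
open import Data.Sum using (_⊎_; inj₁; inj₂; swap)
open import Function using (_∘_)
open import Function.Bundles using (Equivalence)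
open import Relation.Binary.PropositionalEquality using (_≡_; refl; sym; trans; cong; cong₂; subst)
open import Relation.Nullary using (¬_)

∑ : {X : Set} → List X → (X → ℕ) → ℕ
∑ xs f = sum (map f xs)

syntax ∑ xs (λ x → e) = ∑[ x ∈ xs ] e

private
  variable
    X Y H V : Set

∑-cong : (xs : List X) {f g : X → ℕ} → (∀ x → f x ≡ g x) → ∑ xs f ≡ ∑ xs g
∑-cong xs f≗g = cong sum (map-cong f≗g xs)

∑-mono-≤ : (xs : List X) {f g : X → ℕ} → (∀ x → f x ≤ g x) → ∑ xs f ≤ ∑ xs g
∑-mono-≤ []       f≤g = z≤n
∑-mono-≤ (x ∷ xs) f≤g = +-mono-≤ (f≤g x) (∑-mono-≤ xs f≤g)

∑-++ : (xs ys : List X) (f : X → ℕ) → ∑ (xs ++ ys) f ≡ ∑ xs f + ∑ ys f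
∑-++ xs ys f = trans (cong sum (map-++ f xs ys)) (sum-++ (map f xs) (map f ys))

∑-zero : (xs : List X) → ∑[ x ∈ xs ] 0 ≡ 0
∑-zero []       = refl
∑-zero (x ∷ xs) = ∑-zero xs

∑-+ : (xs : List X) (f g : X → ℕ) → ∑[ x ∈ xs ] (f x + g x) ≡ ∑ xs f + ∑ xs g
∑-+ []       f g = refl
∑-+ (x ∷ xs) f g = trans (cong (f x + g x +_) (∑-+ xs f g))
  (interchange +-commutativeSemigroup (f x) (g x) (∑ xs f) (∑ xs g))

∑-*ˡ : (xs : List X) (c : ℕ) (f : X → ℕ) → ∑[ x ∈ xs ] (c * f x) ≡ c * ∑ xs f
∑-*ˡ []       c f = sym (*-zeroʳ c)
∑-*ˡ (x ∷ xs) c f =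
  trans (cong (c * f x +_) (∑-*ˡ xs c f)) (sym (*-distribˡ-+ c (f x) (∑ xs f)))

∑-*ʳ : (xs : List X) (c : ℕ) (f : X → ℕ) → ∑[ x ∈ xs ] (f x * c) ≡ ∑ xs f * c
∑-*ʳ []       c f = refl
∑-*ʳ (x ∷ xs) c f =
  trans (cong (f x * c +_) (∑-*ʳ xs c f)) (sym (*-distribʳ-+ c (f x) (∑ xs f)))

term≤∑ : {xs : List X} {x : X} (f : X → ℕ) → x ∈ xs → f x ≤ ∑ xs f
term≤∑ {xs = y ∷ xs} f (here refl) = m≤m+n (f y) (∑ xs f)
term≤∑ {xs = y ∷ xs} f (there x∈xs) = ≤-trans (term≤∑ f x∈xs) (m≤n+m (∑ xs f) (f y))

∑-map : (g : X → Y) (xs : List X) (f : Y → ℕ) → ∑ (map g xs) f ≡ ∑ xs (f ∘ g)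
∑-map g xs f = cong sum (sym (map-∘ xs))

∑-swap : (xs : List X) (ys : List Y) (f : X → Y → ℕ) →
  ∑[ x ∈ xs ] ∑[ y ∈ ys ] f x y ≡ ∑[ y ∈ ys ] ∑[ x ∈ xs ] f x y
∑-swap []       ys f = sym (∑-zero ys)
∑-swap (x ∷ xs) ys f = trans (cong (∑ ys (f x) +_) (∑-swap xs ys f))
  (sym (∑-+ ys (f x) (λ y → ∑[ x′ ∈ xs ] f x′ y)))

∑-cartesianProduct : (xs : List X) (ys : List Y) (f : X × Y → ℕ) →
  ∑ (cartesianProduct xs ys) f ≡ ∑[ x ∈ xs ] ∑[ y ∈ ys ] f (x , y)
∑-cartesianProduct []       ys f = refl
∑-cartesianProduct (x ∷ xs) ys f = trans (∑-++ (map (x ,_) ys) _ f)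
  (cong₂ _+_ (∑-map (x ,_) ys f) (∑-cartesianProduct xs ys f))

∑∑-* : (xs : List X) (ys : List Y) (f : X → ℕ) (g : Y → ℕ) →
  ∑[ x ∈ xs ] ∑[ y ∈ ys ] (f x * g y) ≡ ∑ xs f * ∑ ys g
∑∑-* xs ys f g = trans (∑-cong xs (λ x → ∑-*ˡ ys (f x) g)) (∑-*ʳ xs (∑ ys g) f)

𝟙 : Bool → ℕ
𝟙 b = if b then 1 else 0

𝟙≤ : (b : Bool) {m : ℕ} → (T b → 1 ≤ m) → 𝟙 b ≤ m
𝟙≤ false _   = z≤n
𝟙≤ true  1≤m = 1≤m _

1≤𝟙 : {b : Bool} → T b → 1 ≤ 𝟙 b
1≤𝟙 {true} _ = ≤-refl

1≤count : {xs : List X} {x : X} (P : X → Bool) → x ∈ xs → T (P x) → 1 ≤ count xs P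
1≤count P x∈xs Px = ≤-trans (1≤𝟙 Px) (term≤∑ (𝟙 ∘ P) x∈xs)

count≤1 : (xs : List X) (P : X → Bool) → Unique xs →
  (∀ {x y} → T (P x) → T (P y) → x ≡ y) → count xs P ≤ 1
count≤1 []       P []             P-unique = z≤n
count≤1 (x ∷ xs) P (x∉xs ∷ xs!) P-unique with P x in Px
... | false = count≤1 xs P xs! P-unique
... | true  = ≤-reflexive (cong suc (count-none x∉xs))
  where
  count-none : ∀ {ys} → All (λ y → ¬ x ≡ y) ys → count ys P ≡ 0
  count-none []           = refl
  count-none {y ∷ _} (x≢y ∷ x∉ys) with P y in Py
  ... | false = count-none x∉ys
  ... | true  = ⊥-elim (x≢y (P-unique (subst T (sym Px) _) (subst T (sym Py) _)))

count≤count-of-witnesses : (hs : List H) (vs : List V)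
  (P : H → Bool) (Q : V → Bool) (R : H → V → Bool) →
  Unique hs → (∀ {h h′ v} → T (R h v) → T (R h′ v) → h ≡ h′) →
  (∀ h → T (P h) → ∃[ v ] v ∈ vs × T (Q v) × T (R h v)) →
  count hs P ≤ count vs Q
count≤count-of-witnesses hs vs P Q R hs! R-injective witness = begin
  count hs P                                ≤⟨ ∑-mono-≤ hs witnessed ⟩
  ∑[ h ∈ hs ] count vs (λ v → Q v ∧ R h v)  ≡⟨ ∑-swap hs vs (λ h v → 𝟙 (Q v ∧ R h v)) ⟩
  ∑[ v ∈ vs ] count hs (λ h → Q v ∧ R h v)  ≤⟨ ∑-mono-≤ vs witnessing-once ⟩
  count vs Q                                ∎
  where
  open ≤-Reasoning

  witnessed : ∀ h → 𝟙 (P h) ≤ count vs (λ v → Q v ∧ R h v)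
  witnessed h = 𝟙≤ (P h) λ Ph →
    let v , v∈vs , Qv , Rhv = witness h Ph in
    1≤count (λ v → Q v ∧ R h v) v∈vs (Equivalence.from T-∧ (Qv , Rhv))

  witnessing-once : ∀ v → count hs (λ h → Q v ∧ R h v) ≤ 𝟙 (Q v)
  witnessing-once v with Q v
  ... | false = ≤-reflexive (∑-zero hs)
  ... | true  = count≤1 hs (λ h → R h v) hs! R-injective

count≤count²-if-lines-hit : (xs : List X) (ys : List Y) (P Q : X × Y → Bool) →
  (∀ i j → T (P (i , j)) →
     (∃[ k ] k ∈ ys × T (Q (i , k))) × (∃[ k ] k ∈ xs × T (Q (k , j)))) →
  count (cartesianProduct xs ys) P ≤
    count (cartesianProduct xs ys) Q * count (cartesianProduct xs ys) Q
count≤count²-if-lines-hit {X} {Y} xs ys P Q lines-hit = begin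
  count (cartesianProduct xs ys) P          ≡⟨ ∑-cartesianProduct xs ys (𝟙 ∘ P) ⟩
  ∑[ i ∈ xs ] ∑[ j ∈ ys ] 𝟙 (P (i , j))     ≤⟨ ∑-mono-≤ xs (λ i → ∑-mono-≤ ys (λ j → 𝟙≤ _ (hit i j))) ⟩
  ∑[ i ∈ xs ] ∑[ j ∈ ys ] (row i * col j)   ≡⟨ ∑∑-* xs ys row col ⟩
  ∑ xs row * ∑ ys col                       ≡⟨ cong₂ _*_ ∑row≡count ∑col≡count ⟩
  count (cartesianProduct xs ys) Q * count (cartesianProduct xs ys) Q ∎
  where
  open ≤-Reasoning

  row : X → ℕ
  row i = count ys (λ j → Q (i , j))

  col : Y → ℕ
  col j = count xs (λ i → Q (i , j))

  hit : ∀ i j → T (P (i , j)) → 1 ≤ row i * col j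
  hit i j Pij =
    let (k , k∈ys , Qik) , (k′ , k′∈xs , Qk′j) = lines-hit i j Pij in
    *-mono-≤ (1≤count (λ j → Q (i , j)) k∈ys Qik) (1≤count (λ i → Q (i , j)) k′∈xs Qk′j)

  ∑row≡count : ∑ xs row ≡ count (cartesianProduct xs ys) Q
  ∑row≡count = sym (∑-cartesianProduct xs ys (𝟙 ∘ Q))

  ∑col≡count : ∑ ys col ≡ count (cartesianProduct xs ys) Q
  ∑col≡count = trans (∑-swap ys xs (λ j i → 𝟙 (Q (i , j)))) (sym (∑-cartesianProduct xs ys (𝟙 ∘ Q)))

data Walk (E : V → V → Set) (S : V → Set) : V → V → Set where
  here : ∀ {u} → S u → Walk E S u u
  step : ∀ {u v w} → S u → E u v → Walk E S v w → Walk E S u w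

module _ {E : V → V → Set} {A B : V → Bool} (sep : IsSeparation E A B) where

  separation-edge : ∀ {u v} → E u v → T (A u) → T (B u) ⊎ T (A v)
  separation-edge {u} {v} e Au with B u | A v | proj₁ sep v | proj₂ sep u v e Au
  ... | true  | _     | _       | _      = inj₁ _
  ... | false | true  | _       | _      = inj₂ _
  ... | false | false | inj₂ Bv | no-edge = ⊥-elim (no-edge _ Bv _)

  walk-meets-separator : ∀ {S u w} → Walk E S u w → T (A u) → T (B w) →
    ∃[ v ] S v × T (A v) × T (B v)
  walk-meets-separator (here Su) Au Bu = _ , Su , Au , Bu
  walk-meets-separator (step Su e walk) Au Bw with separation-edge e Au
  ... | inj₁ Bu = _ , Su , Au , Bu
  ... | inj₂ Av = walk-meets-separator walk Av Bw

IsSeparation-swap : {E : V → V → Set} {A B : V → Bool} → (∀ u v → E u v → E v u) →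
  IsSeparation E A B → IsSeparation E B A
IsSeparation-swap E-sym (cover , no-edge) =
  (λ v → swap (cover v)) , λ u v e Bu ¬Au Av ¬Bv → no-edge v u (E-sym u v e) Av ¬Bv Bu ¬Au

IsPath : {r : ℕ} → (V → V → Set) → (Fin r → V) → Set
IsPath E f = ∀ x y → toℕ y ≡ suc (toℕ x) → E (f x) (f y)

path-walk : {E : V → V → Set} {r : ℕ} (f : Fin r → V) → IsPath E f →
  ∀ x y → toℕ x ≤ toℕ y → Walk E (λ v → ∃[ k ] v ≡ f k) (f x) (f y)
path-walk {V} {E} {r} f path x y x≤y = go (toℕ y ∸ toℕ x) x (m∸n+n≡m x≤y)
  where
  go : ∀ d x → d + toℕ x ≡ toℕ y → Walk E (λ v → ∃[ k ] v ≡ f k) (f x) (f y)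
  go zero    x x≡y with toℕ-injective x≡y
  ... | refl = here (x , refl)
  go (suc d) x d+1+x≡y = step (x , refl) (path x x′ x′≡1+x)
    (go d x′ (trans (cong (d +_) x′≡1+x) (trans (+-suc d (toℕ x)) d+1+x≡y)))
    where
    1+x<r : suc (toℕ x) < r
    1+x<r = ≤-<-trans (subst (suc (toℕ x) ≤_) d+1+x≡y (s≤s (m≤n+m (toℕ x) d))) (toℕ<n y)
    x′ : Fin r
    x′ = fromℕ< 1+x<r
    x′≡1+x : toℕ x′ ≡ suc (toℕ x)
    x′≡1+x = toℕ-fromℕ< 1+x<r

path-meets-separator : {E : V → V → Set} {A B : V → Bool} {r : ℕ} →
  IsSeparation E A B → (∀ u v → E u v → E v u) → (f : Fin r → V) → IsPath E f →
  ∀ x y → T (A (f x)) → T (B (f y)) → ∃[ k ] T (A (f k)) × T (B (f k))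
path-meets-separator sep E-sym f path x y Ax By with ≤-total (toℕ x) (toℕ y)
... | inj₁ x≤y with walk-meets-separator sep (path-walk f path x y x≤y) Ax By
...   | _ , (k , refl) , Ak , Bk = k , Ak , Bk
path-meets-separator sep E-sym f path x y Ax By | inj₂ y≤x
  with walk-meets-separator (IsSeparation-swap E-sym sep) (path-walk f path y x y≤x) By Ax
...   | _ , (k , refl) , Bk , Ak = k , Ak , Bk

∣m-1+m∣≡1 : ∀ m → ∣ m - suc m ∣ ≡ 1
∣m-1+m∣≡1 m = trans (cong (∣ m -_∣) (+-comm 1 m)) (∣m-m+n∣≡n m 1)

GridAdj-sym : (r : ℕ) (h h′ : GridV r) → GridAdj r h h′ → GridAdj r h′ h
GridAdj-sym r (i , j) (i′ , j′) adj =
  trans (cong₂ _+_ (∣-∣-comm (toℕ i′) (toℕ i)) (∣-∣-comm (toℕ j′) (toℕ j))) adj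

row-path : {r : ℕ} (i : Fin r) → IsPath (GridAdj r) (i ,_)
row-path i x y y≡1+x rewrite y≡1+x | ∣n-n∣≡0 (toℕ i) = ∣m-1+m∣≡1 (toℕ x)

column-path : {r : ℕ} (j : Fin r) → IsPath (GridAdj r) (_, j)
column-path j x y y≡1+x rewrite y≡1+x | ∣n-n∣≡0 (toℕ j) =
  trans (+-identityʳ _) (∣m-1+m∣≡1 (toℕ x))

grid-count≤order² : {r : ℕ} {A B : GridV r → Bool} →
  IsSeparation (GridAdj r) A B → ContainsCross r B →
  count (gridVerts r) A ≤ order (gridVerts r) A B * order (gridVerts r) A B
grid-count≤order² {r} {A} {B} sep (i₀ , j₀ , cross) =
  count≤count²-if-lines-hit (allFin r) (allFin r) A (λ h → A h ∧ B h) lines-hit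
  where
  line-hit : (f : Fin r → GridV r) → IsPath (GridAdj r) f → ∀ x y → T (A (f x)) → T (B (f y)) →
    ∃[ k ] k ∈ allFin r × T (A (f k) ∧ B (f k))
  line-hit f path x y Afx Bfy =
    let k , Afk , Bfk = path-meets-separator sep (GridAdj-sym r) f path x y Afx Bfy in
    k , ∈-allFin k , Equivalence.from T-∧ (Afk , Bfk)

  lines-hit : ∀ i j → T (A (i , j)) →
    (∃[ k ] k ∈ allFin r × T (A (i , k) ∧ B (i , k))) ×
    (∃[ k ] k ∈ allFin r × T (A (k , j) ∧ B (k , j)))
  lines-hit i j Aij =
    line-hit (i ,_) (row-path i) j j₀ Aij (proj₂ (cross i)) ,
    line-hit (_, j) (column-path j) i i₀ Aij (proj₁ (cross j))

WalkIn⇒Walk : {G : Graph} {S : Fin (n G) → Bool} {u v : Fin (n G)} →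
  WalkIn G S u v → Walk (Adj G) (T ∘ S) u v
WalkIn⇒Walk (here Su)        = here Su
WalkIn⇒Walk (step Su e walk) = step Su e (WalkIn⇒Walk walk)

induced-witness : {G : Graph} {r : ℕ} (M : GridMinor G r) (X : Fin (n G) → Bool) →
  ∀ h → T (induced M X h) → ∃[ v ] T (branch M h v) × T (X v)
induced-witness {G} M X h Xh =
  let v , BXv = satisfied (any⁻ (λ v → branch M h v ∧ X v) (allFin (n G)) Xh) in
  v , Equivalence.to T-∧ BXv

induced-order≤order : {G : Graph} {r : ℕ} (M : GridMinor G r) {A B : Fin (n G) → Bool} →
  IsSeparation (Adj G) A B →
  order (gridVerts r) (induced M A) (induced M B) ≤ orderG G A B
induced-order≤order {G} {r} M {A} {B} sep =
  count≤count-of-witnesses (gridVerts r) (allFin (n G)) _ _ (branch M)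
    (cartesianProduct⁺ (allFin⁺ r) (allFin⁺ r)) (λ {h} {h′} {v} → disjoint M h h′ v) witness
  where
  witness : ∀ h → T (induced M A h ∧ induced M B h) →
    ∃[ v ] v ∈ allFin (n G) × T (A v ∧ B v) × T (branch M h v)
  witness h A′B′h =
    let A′h , B′h       = Equivalence.to T-∧ A′B′h
        u , Vu , Au      = induced-witness M A h A′h
        w , Vw , Bw      = induced-witness M B h B′h
        v , Vv , Av , Bv = walk-meets-separator sep (WalkIn⇒Walk (connected M h u w Vu Vw)) Au Bw
    in v , ∈-allFin v , Equivalence.from T-∧ (Av , Bv) , Vv

corollary1 : (G : Graph) (r : ℕ) (M : GridMinor G r) (A B : Fin (n G) → Bool) →
    InExtension G r M A B →
    count (gridVerts r) (induced M A) ≤ orderG G A B * orderG G A B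
corollary1 G r M A B (sep , _ , grid-sep , _ , cross) =
  ≤-trans (grid-count≤order² grid-sep cross) (*-mono-≤ induced-order≤s induced-order≤s)
  where
  induced-order≤s : order (gridVerts r) (induced M A) (induced M B) ≤ orderG G A B
  induced-order≤s = induced-order≤order M sep
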